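{- For every positive integer $s$ and $g(i)=\left\lfloor\frac{\lg i}{s}\right\rfloor$ (for $i\ge1$, with $g(0)=0$), there exists $k$ such that for all $N$, $N\not\longrightarrow(k)^2_g$; that is, for every $N$ there is a $g$-regressive coloring $c:[N]^2\to\mathbb{N}$ with no homogeneous subset of $N$ of size $k$.
   Context: $\lg$ is the base-2 logarithm. A natural number $N$ is identified with $\{0,1,\dots,N-1\}$, and $[X]^2$ denotes the set of two-element subsets of $X$. A coloring $c:[N]^2\to\mathbb{N}$ is $g$-regressive if $c(\{m,n\})\le g(\min\{m,n\})$ for all pairs. A set $B$ is homogeneous for $c$ if $c$ is constant on $[B]^2$. $N\longrightarrow(k)^2_g$ means every $g$-regressive coloring of $[N]^2$ has a homogeneous set of size $k$. -}

module Defs where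

open import Data.Nat using (ℕ; zero; suc; _<_; _≤_; _/_)
open import Data.Nat.Logarithm using (⌊log₂_⌋)
open import Data.Fin using (Fin; toℕ)
open import Data.Fin.Base using () renaming (_<_ to _<ᶠ_)
open import Relation.Binary.PropositionalEquality using (_≡_)
open import Data.Product using (∃-syntax; _×_)

-- g_s(i) = ⌊ (lg i) / s ⌋ for i ≥ 1, g_s(0) = 0.
-- For integer s ≥ 1, ⌊ (lg i)/s ⌋ = ⌊ ⌊lg i⌋ / s ⌋; also ⌊log₂ 0⌋ = 0.
g : (s : ℕ) → ℕ → ℕ
g s zero = zero
g (suc s) (suc i) = ⌊log₂ (suc i) ⌋ / suc s
g zero (suc i) = zero   -- unused: s is required positive

-- A coloring of [N]^2: c m n is the colour of {m, n}, read for m < n < N.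
Coloring : Set
Coloring = ℕ → ℕ → ℕ

Regressive : (f : ℕ → ℕ) (N : ℕ) → Coloring → Set
Regressive f N c = ∀ m n → m < n → n < N → c m n ≤ f m

Homogeneous : (N k : ℕ) → Coloring → (Fin k → ℕ) → Set
Homogeneous N k c b =
  (∀ i j → i <ᶠ j → b i < b j) ×
  (∀ i → b i < N) ×
  ∃[ col ] (∀ i j → i <ᶠ j → c (b i) (b j) ≡ col)

Arrows : (N k : ℕ) (f : ℕ → ℕ) → Set
Arrows N k f = ∀ c → Regressive f N c → ∃[ b ] Homogeneous N k c b

module Submission where

-- Colour {m, n} by g(min(m, n − m)); this is regressive since min(m, n − m) ≤ m. If B is homogeneous
-- of colour c, then every pair m < n of B has n − m ≥ 2^(cs) and min(m, n − m) < 2^((c+1)s).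
-- With 2·2^s + 1 elements, consecutive gaps of 2^(cs) push the middle element m to at least
-- 2^s · 2^(cs) and the last element n to at least m + 2^s · 2^(cs), so min(m, n − m) is too large.

open import Defs
open import Data.Nat using (ℕ; _≤_)
open import Data.Product using (∃-syntax; _×_)
open import Relation.Nullary using (¬_)

open import Data.Nat using (zero; suc; _+_; _*_; _∸_; _^_; _<_; _⊓_; _/_; _%_; z≤n; s≤s; z<s; ⌊_/2⌋; ⌈_/2⌉; NonZero)
open import Data.Nat.Properties
open import Data.Nat.DivMod using (m≡m%n+[m/n]*n; m%n<n; m/n*n≤m; /-monoˡ-≤)
open import Data.Nat.Logarithm using (⌊log₂_⌋; ⌊log₂⌋-mono-≤; ⌊log₂⌊n/2⌋⌋≡⌊log₂n⌋∸1; ⌊log₂[2^n]⌋≡n)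
open import Data.Fin using (Fin; fromℕ<) renaming (_<_ to _<ᶠ_)
open import Data.Fin.Properties using (toℕ-fromℕ<; fromℕ<-cong)
open import Data.Product using (_,_; ∃₂)
open import Relation.Binary.PropositionalEquality using (refl; sym; trans; cong; subst; subst₂)

⌊n/2⌋<m : ∀ {m} n → n < 2 * m → ⌊ n /2⌋ < m
⌊n/2⌋<m {m} n n<2m = ≰⇒> λ m≤⌊n/2⌋ → <⇒≱ n<2m (begin
  2 * m               ≡⟨ cong (m +_) (+-identityʳ m) ⟩
  m + m               ≤⟨ +-mono-≤ m≤⌊n/2⌋ (≤-trans m≤⌊n/2⌋ (⌊n/2⌋≤⌈n/2⌉ n)) ⟩
  ⌊ n /2⌋ + ⌈ n /2⌉   ≡⟨ ⌊n/2⌋+⌈n/2⌉≡n n ⟩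
  n                   ∎)
  where open ≤-Reasoning

m<[1+m/n]*n : ∀ m n .{{_ : NonZero n}} → m < suc (m / n) * n
m<[1+m/n]*n m n = begin-strict
  m                  ≡⟨ m≡m%n+[m/n]*n m n ⟩
  m % n + m / n * n  <⟨ +-monoˡ-< (m / n * n) (m%n<n m n) ⟩
  n + m / n * n      ∎
  where open ≤-Reasoning

n<2^[1+k]⇒⌊log₂n⌋≤k : ∀ k {n} → n < 2 ^ suc k → ⌊log₂ n ⌋ ≤ k
n<2^[1+k]⇒⌊log₂n⌋≤k zero    {0}           _ = z≤n
n<2^[1+k]⇒⌊log₂n⌋≤k zero    {1}           _ = z≤n
n<2^[1+k]⇒⌊log₂n⌋≤k zero    {suc (suc _)} (s≤s (s≤s ()))
n<2^[1+k]⇒⌊log₂n⌋≤k (suc k) {n}           n<2^[2+k] = begin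
  ⌊log₂ n ⌋                ≤⟨ m≤n+m∸n ⌊log₂ n ⌋ 1 ⟩
  suc (⌊log₂ n ⌋ ∸ 1)      ≡⟨ cong suc (⌊log₂⌊n/2⌋⌋≡⌊log₂n⌋∸1 n) ⟨
  suc ⌊log₂ ⌊ n /2⌋ ⌋      ≤⟨ s≤s (n<2^[1+k]⇒⌊log₂n⌋≤k k (⌊n/2⌋<m n n<2^[2+k])) ⟩
  suc k                    ∎
  where open ≤-Reasoning

k≤⌊log₂n⌋⇒2^k≤n : ∀ k {n} → 0 < n → k ≤ ⌊log₂ n ⌋ → 2 ^ k ≤ n
k≤⌊log₂n⌋⇒2^k≤n zero    0<n _ = 0<n
k≤⌊log₂n⌋⇒2^k≤n (suc k) _   k<⌊log₂n⌋ =
  ≮⇒≥ λ n<2^[1+k] → <⇒≱ k<⌊log₂n⌋ (n<2^[1+k]⇒⌊log₂n⌋≤k k n<2^[1+k])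

n<2^[1+⌊log₂n⌋] : ∀ n → n < 2 ^ suc ⌊log₂ n ⌋
n<2^[1+⌊log₂n⌋] n = ≰⇒> λ 2^[1+l]≤n →
  <-irrefl refl (subst (_≤ ⌊log₂ n ⌋) (⌊log₂[2^n]⌋≡n (suc ⌊log₂ n ⌋))
    (⌊log₂⌋-mono-≤ 2^[1+l]≤n))

g-mono-≤ : ∀ s {m n} → m ≤ n → g s m ≤ g s n
g-mono-≤ s       {zero}            _         = z≤n
g-mono-≤ zero    {suc _} {suc _}   _         = z≤n
g-mono-≤ (suc s) {suc _} {suc _}   m≤n       = /-monoˡ-≤ (suc s) (⌊log₂⌋-mono-≤ m≤n)

2^[g*s]≤n : ∀ s {n} → 0 < n → 2 ^ (g (suc s) n * suc s) ≤ n
2^[g*s]≤n s {suc i} 0<n = k≤⌊log₂n⌋⇒2^k≤n _ 0<n (m/n*n≤m ⌊log₂ suc i ⌋ (suc s))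

n<2^[[1+g]*s] : ∀ s n → n < 2 ^ (suc (g (suc s) n) * suc s)
n<2^[[1+g]*s] s zero    = m^n>0 2 (suc s + 0)
n<2^[[1+g]*s] s (suc i) = <-≤-trans (n<2^[1+⌊log₂n⌋] (suc i))
  (^-monoʳ-≤ 2 (m<[1+m/n]*n ⌊log₂ suc i ⌋ (suc s)))

minGapColoring : ℕ → Coloring
minGapColoring s m n = g s (m ⊓ (n ∸ m))

minGapColoring-regressive : ∀ s N → Regressive (g s) N (minGapColoring s)
minGapColoring-regressive s N m n _ _ = g-mono-≤ s (m⊓n≤m m (n ∸ m))

minGapColoring-gap : ∀ s {m n} → m < n → m + 2 ^ (minGapColoring (suc s) m n * suc s) ≤ n
minGapColoring-gap s {zero}  {n}     0<n = 0<n
minGapColoring-gap s {suc m} {suc n} m<n = begin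
  suc m + 2 ^ (g (suc s) (suc m ⊓ d) * suc s)  ≤⟨ +-monoʳ-≤ (suc m) (2^[g*s]≤n s 0<min) ⟩
  suc m + suc m ⊓ d                            ≤⟨ +-monoʳ-≤ (suc m) (m⊓n≤n (suc m) d) ⟩
  suc m + d                                    ≡⟨ m+[n∸m]≡n (<⇒≤ m<n) ⟩
  suc n                                        ∎
  where
  open ≤-Reasoning
  d = suc n ∸ suc m
  0<min : 0 < suc m ⊓ d
  0<min = ⊓-glb z<s (m<n⇒0<n∸m m<n)

minGapColoring-narrow : ∀ s m n →
  m ⊓ (n ∸ m) < 2 ^ suc s * 2 ^ (minGapColoring (suc s) m n * suc s)
minGapColoring-narrow s m n =
  subst (m ⊓ (n ∸ m) <_) (^-distribˡ-+-* 2 (suc s) (minGapColoring (suc s) m n * suc s))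
    (n<2^[[1+g]*s] s (m ⊓ (n ∸ m)))

fromℕ<-mono-< : ∀ {k i j} (i<k : i < k) (j<k : j < k) → i < j → fromℕ< i<k <ᶠ fromℕ< j<k
fromℕ<-mono-< i<k j<k = subst₂ _<_ (sym (toℕ-fromℕ< i<k)) (sym (toℕ-fromℕ< j<k))

module _ {k M : ℕ} (b : Fin k → ℕ) (gap : ∀ i j → i <ᶠ j → b i + M ≤ b j) where

  spread : ∀ i d (i<k : i < k) (i+d<k : i + d < k) → b (fromℕ< i<k) + d * M ≤ b (fromℕ< i+d<k)
  spread i zero    i<k i+0<k = ≤-reflexive (trans (+-identityʳ _)
    (cong b (fromℕ<-cong i (i + 0) (sym (+-identityʳ i)) i<k i+0<k)))
  spread i (suc d) i<k i+1+d<k = begin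
    b (fromℕ< i<k) + (M + d * M)   ≡⟨ cong (b (fromℕ< i<k) +_) (+-comm M (d * M)) ⟩
    b (fromℕ< i<k) + (d * M + M)   ≡⟨ +-assoc (b (fromℕ< i<k)) (d * M) M ⟨
    b (fromℕ< i<k) + d * M + M     ≤⟨ +-monoˡ-≤ M (spread i d i<k i+d<k) ⟩
    b (fromℕ< i+d<k) + M           ≤⟨ gap _ _ (fromℕ<-mono-< i+d<k i+1+d<k i+d<i+1+d) ⟩
    b (fromℕ< i+1+d<k)             ∎
    where
    open ≤-Reasoning
    i+d<i+1+d : i + d < i + suc d
    i+d<i+1+d = +-monoʳ-< i (n<1+n d)
    i+d<k : i + d < k
    i+d<k = <-trans i+d<i+1+d i+1+d<k

wide-pair : ∀ {d M} (b : Fin (suc (d + d)) → ℕ) → (∀ i j → i <ᶠ j → b i + M ≤ b j) → 0 < d →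
            ∃₂ λ i j → i <ᶠ j × d * M ≤ b i ⊓ (b j ∸ b i)
wide-pair {d} {M} b gap 0<d = middle , last , middle<last , ⊓-glb middle-far last-far
  where
  d<2d+1 : d < suc (d + d)
  d<2d+1 = s≤s (m≤m+n d d)
  2d<2d+1 : d + d < suc (d + d)
  2d<2d+1 = ≤-refl
  middle last : Fin (suc (d + d))
  middle = fromℕ< d<2d+1
  last = fromℕ< 2d<2d+1
  middle<last : middle <ᶠ last
  middle<last = fromℕ<-mono-< d<2d+1 2d<2d+1 (m<m+n d 0<d)
  middle-far : d * M ≤ b middle
  middle-far = ≤-trans (m≤n+m (d * M) _) (spread b gap 0 d z<s d<2d+1)
  last-far : d * M ≤ b last ∸ b middle
  last-far = m+n≤o⇒m≤o∸n (d * M)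
    (subst (_≤ b last) (+-comm (b middle) (d * M)) (spread b gap d d d<2d+1 2d<2d+1))

minGapColoring-noHomogeneous : ∀ s N b →
  ¬ Homogeneous N (suc (2 ^ suc s + 2 ^ suc s)) (minGapColoring (suc s)) b
minGapColoring-noHomogeneous s N b (increasing , _ , c , constant) =
  no-wide-pair (wide-pair b gap (m^n>0 2 (suc s)))
  where
  gap : ∀ i j → i <ᶠ j → b i + 2 ^ (c * suc s) ≤ b j
  gap i j i<j = subst (λ c → b i + 2 ^ (c * suc s) ≤ b j) (constant i j i<j)
    (minGapColoring-gap s (increasing i j i<j))
  narrow : ∀ i j → i <ᶠ j → b i ⊓ (b j ∸ b i) < 2 ^ suc s * 2 ^ (c * suc s)
  narrow i j i<j = subst (λ c → b i ⊓ (b j ∸ b i) < 2 ^ suc s * 2 ^ (c * suc s)) (constant i j i<j)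
    (minGapColoring-narrow s (b i) (b j))
  no-wide-pair : ¬ ∃₂ λ i j → i <ᶠ j × 2 ^ suc s * 2 ^ (c * suc s) ≤ b i ⊓ (b j ∸ b i)
  no-wide-pair (i , j , i<j , wide) = <⇒≱ (narrow i j i<j) wide

mainTheorem7 : (s : ℕ) → 1 ≤ s → ∃[ k ] ((N : ℕ) →
    ∃[ c ] (Regressive (g s) N c × (∀ b → ¬ Homogeneous N k c b)))
mainTheorem7 (suc s) _ = suc (2 ^ suc s + 2 ^ suc s) , λ N →
  minGapColoring (suc s) , minGapColoring-regressive (suc s) N , minGapColoring-noHomogeneous s N
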